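{- (1) If an $\mathrm{A}$-frame $F$ is $m$-transitive and a $\mathrm{B}$-frame $G$ is $n$-transitive ($\mathrm{A},\mathrm{B}$ disjoint finite alphabets), then $F\times G$ is $(m+n)$-transitive. (2) The product of two pretransitive logics is pretransitive.
   Context: For a frame $F$ with relations $(R_\lozenge)$, $R_F$ is their union, $R^0$ the identity, $R^{i+1}=R\circ R^i$, $R^{\le m}=\bigcup_{i\le m}R^i$, $R^*=\bigcup_{i<\omega}R^i$. $F$ is $m$-transitive if $R_F^{\le m}=R_F^*$. For an alphabet $\mathrm{C}$, $\lozenge_{\mathrm{C}}\varphi=\bigvee_{\lozenge\in\mathrm{C}}\lozenge\varphi$, $\lozenge^{\le m}\varphi=\bigvee_{i\le m}\lozenge^i\varphi$; a $\mathrm{C}$-logic is $m$-transitive if it contains $\lozenge_{\mathrm{C}}^{m+1}p\to\lozenge_{\mathrm{C}}^{\le m}p$, and pretransitive if it is $m$-transitive for some $m$. $F\times G$ (on $X\times Y$) has, for each relation $R$ of $F$, $(a,b)R^h(a',b)$ iff $aRa'$, and for each relation $S$ of $G$, $(a,b)S^v(a,b')$ iff $bSb'$. For an $\mathrm{A}$-logic $L_1$ and $\mathrm{B}$-logic $L_2$, $L_1\times L_2$ is the set of formulas valid in all $F\times G$ with $F\models L_1$, $G\models L_2$. -}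

module Defs where

open import Data.Nat using (ℕ; zero; suc; _≤_)
open import Data.List using (List; []; _∷_; _++_; map; upTo)
open import Data.List.Membership.Propositional using (_∈_)
open import Data.List.Membership.Propositional.Properties using (∈-++⁺ˡ; ∈-++⁺ʳ; ∈-map⁺)
open import Data.Product using (Σ; _×_; _,_)
open import Data.Sum using (_⊎_; inj₁; inj₂)
open import Data.Empty using (⊥)
open import Relation.Nullary using (¬_)
open import Relation.Binary.PropositionalEquality using (_≡_)

record Alphabet : Set₁ where
  field
    Sym      : Set
    elems    : List Sym
    complete : (c : Sym) → c ∈ elems
open Alphabet public

_⊕_ : Alphabet → Alphabet → Alphabet
A ⊕ B = record
  { Sym      = Sym A ⊎ Sym B
  ; elems    = map inj₁ (elems A) ++ map inj₂ (elems B)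
  ; complete = λ { (inj₁ a) → ∈-++⁺ˡ (∈-map⁺ inj₁ (complete A a))
                 ; (inj₂ b) → ∈-++⁺ʳ (map inj₁ (elems A)) (∈-map⁺ inj₂ (complete B b)) } }

record Frame (C : Alphabet) : Set₁ where
  field
    W   : Set
    Rel : Sym C → W → W → Set
open Frame public

RU : ∀ {C} (F : Frame C) → W F → W F → Set
RU {C} F x y = Σ (Sym C) λ c → Rel F c x y

Rpow : ∀ {C} (F : Frame C) → ℕ → W F → W F → Set
Rpow F zero    x y = x ≡ y
Rpow F (suc i) x z = Σ (W F) λ y → RU F x y × Rpow F i y z

Rle : ∀ {C} (F : Frame C) → ℕ → W F → W F → Set
Rle F m x y = Σ ℕ λ i → i ≤ m × Rpow F i x y

Rstar : ∀ {C} (F : Frame C) → W F → W F → Set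
Rstar F x y = Σ ℕ λ i → Rpow F i x y

mTransitive : ∀ {C} → Frame C → ℕ → Set
mTransitive F m =
  ((x y : W F) → Rle F m x y → Rstar F x y) ×
  ((x y : W F) → Rstar F x y → Rle F m x y)

_×F_ : ∀ {A B} → Frame A → Frame B → Frame (A ⊕ B)
F ×F G = record
  { W   = W F × W G
  ; Rel = λ { (inj₁ a) (x , y) (x' , y') → Rel F a x x' × y ≡ y'
            ; (inj₂ b) (x , y) (x' , y') → x ≡ x' × Rel G b y y' } }

data Formula (C : Alphabet) : Set where
  var  : ℕ → Formula C
  ⊥'   : Formula C
  _⇒_  : Formula C → Formula C → Formula C
  ◇    : Sym C → Formula C → Formula C

infixr 5 _⇒_

¬' : ∀ {C} → Formula C → Formula C
¬' φ = φ ⇒ ⊥'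

_∨'_ : ∀ {C} → Formula C → Formula C → Formula C
φ ∨' ψ = ¬' φ ⇒ ψ

□ : ∀ {C} → Sym C → Formula C → Formula C
□ c φ = ¬' (◇ c (¬' φ))

⋁ : ∀ {C} → List (Formula C) → Formula C
⋁ []       = ⊥'
⋁ (φ ∷ φs) = φ ∨' ⋁ φs

◇C : ∀ {C} → Formula C → Formula C
◇C {C} φ = ⋁ (map (λ c → ◇ c φ) (elems C))

◇C^ : ∀ {C} → ℕ → Formula C → Formula C
◇C^ zero    φ = φ
◇C^ (suc i) φ = ◇C (◇C^ i φ)

◇C^≤ : ∀ {C} → ℕ → Formula C → Formula C
◇C^≤ m φ = ⋁ (map (λ i → ◇C^ i φ) (upTo (suc m)))

transAx : ∀ {C} → ℕ → Formula C
transAx m = ◇C^ (suc m) (var 0) ⇒ ◇C^≤ m (var 0)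

substF : ∀ {C} → (ℕ → Formula C) → Formula C → Formula C
substF σ (var p) = σ p
substF σ ⊥'      = ⊥'
substF σ (φ ⇒ ψ) = substF σ φ ⇒ substF σ ψ
substF σ (◇ c φ) = ◇ c (substF σ φ)

-- Classical Kripke semantics (rendered constructively via the
-- double-negation translation, so that every truth value is stable)

sat : ∀ {C} (F : Frame C) → (ℕ → W F → Set) → W F → Formula C → Set
sat F V x (var p) = ¬ ¬ V p x
sat F V x ⊥'      = ⊥
sat F V x (φ ⇒ ψ) = sat F V x φ → sat F V x ψ
sat F V x (◇ c φ) = ¬ ((y : W F) → Rel F c x y → ¬ sat F V y φ)

_⊨_ : ∀ {C} → Frame C → Formula C → Set₁
F ⊨ φ = (V : ℕ → W F → Set) (x : W F) → sat F V x φ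

Logic : Alphabet → Set₂
Logic C = Formula C → Set₁

record Normal {C} (L : Logic C) : Set₁ where
  field
    ax1  : ∀ φ ψ → L (φ ⇒ ψ ⇒ φ)
    ax2  : ∀ φ ψ χ → L ((φ ⇒ ψ ⇒ χ) ⇒ (φ ⇒ ψ) ⇒ φ ⇒ χ)
    ax3  : ∀ φ ψ → L ((¬' φ ⇒ ¬' ψ) ⇒ ψ ⇒ φ)
    axK  : ∀ c φ ψ → L (□ c (φ ⇒ ψ) ⇒ □ c φ ⇒ □ c ψ)
    mp   : ∀ φ ψ → L (φ ⇒ ψ) → L φ → L ψ
    sub  : ∀ σ φ → L φ → L (substF σ φ)
    nec  : ∀ c φ → L φ → L (□ c φ)

mTransitiveL : ∀ {C} → Logic C → ℕ → Set₁
mTransitiveL L m = L (transAx m)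

Pretransitive : ∀ {C} → Logic C → Set₁
Pretransitive L = Σ ℕ λ m → mTransitiveL L m

_⊨L_ : ∀ {C} → Frame C → Logic C → Set₁
F ⊨L L = ∀ φ → L φ → F ⊨ φ

_×L_ : ∀ {A B} → Logic A → Logic B → Logic (A ⊕ B)
(L₁ ×L L₂) φ = (F : Frame _) (G : Frame _) → F ⊨L L₁ → G ⊨L L₂ → (F ×F G) ⊨ φ

-- Horizontal and vertical steps of F × G commute, so a path in the product
-- projects to a path in F and a path in G; shortening these to length ≤ m
-- and ≤ n and replaying them one after the other gives a product path of
-- length ≤ m + n.  For logics: a frame of an m-transitive logic validates
-- the m-transitivity axiom, which (by the usual frame correspondence with a
-- singleton valuation) makes the frame m-transitive; then (1) applies, and
-- an (m + n)-transitive frame validates the (m + n)-transitivity axiom.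
-- Since the semantics is the double-negation translation, the frame
-- correspondence only yields R^* ⊆ ¬ ¬ R^{≤ m}, which is what is carried
-- through.
module Submission where

open import Defs
open import Data.Nat using (ℕ; zero; suc; _+_; _≤_; z≤n; s≤s; s≤s⁻¹)
open import Data.Nat.Properties using (+-mono-≤; m≤n⇒m<n∨m≡n)
open import Data.List using (List; []; _∷_; map; upTo)
open import Data.List.Relation.Unary.Any using (here; there)
open import Data.List.Membership.Propositional using (_∈_)
open import Data.List.Membership.Propositional.Properties using (∈-upTo⁺; ∈-upTo⁻)
open import Data.Product using (Σ; _×_; _,_)
open import Data.Sum using (inj₁; inj₂)
open import Effect.Monad using (RawMonad)
open import Function using (case_of_)
open import Relation.Nullary using (¬_)
open import Relation.Nullary.Negation using (¬¬-Monad; contradiction)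
open import Relation.Binary.PropositionalEquality using (_≡_; refl)
open import Level using (0ℓ)

open RawMonad (¬¬-Monad {0ℓ}) using (_>>=_; _<$>_; return)

¬¬-mTransitive : ∀ {C} → Frame C → ℕ → Set
¬¬-mTransitive F m = (x y : W F) → Rstar F x y → ¬ ¬ Rle F m x y

Rle⇒Rstar : ∀ {C} (F : Frame C) {m} x y → Rle F m x y → Rstar F x y
Rle⇒Rstar F x y (i , _ , p) = i , p

Rpow-++ : ∀ {C} (F : Frame C) {k l x y z} →
          Rpow F k x y → Rpow F l y z → Rpow F (k + l) x z
Rpow-++ F {zero}  refl        q = q
Rpow-++ F {suc k} (y , r , p) q = y , r , Rpow-++ F p q

module _ {A B : Alphabet} (F : Frame A) (G : Frame B) where

  Rpow-horizontal : ∀ {k x x' y} →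
                    Rpow F k x x' → Rpow (F ×F G) k (x , y) (x' , y)
  Rpow-horizontal {zero}  refl                  = refl
  Rpow-horizontal {suc k} (x₁ , (a , r) , p) =
    (x₁ , _) , (inj₁ a , r , refl) , Rpow-horizontal p

  Rpow-vertical : ∀ {l x y y'} →
                  Rpow G l y y' → Rpow (F ×F G) l (x , y) (x , y')
  Rpow-vertical {zero}  refl                  = refl
  Rpow-vertical {suc l} (y₁ , (b , r) , p) =
    (_ , y₁) , (inj₂ b , refl , r) , Rpow-vertical p

  Rle-×F : ∀ {m n x x' y y'} → Rle F m x x' → Rle G n y y' →
           Rle (F ×F G) (m + n) (x , y) (x' , y')
  Rle-×F (k , k≤m , p) (l , l≤n , q) =
    k + l , +-mono-≤ k≤m l≤n , Rpow-++ (F ×F G) (Rpow-horizontal p) (Rpow-vertical q)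

  Rpow-×F-proj : ∀ i {x y x' y'} → Rpow (F ×F G) i (x , y) (x' , y') →
                 Rstar F x x' × Rstar G y y'
  Rpow-×F-proj zero    refl = (0 , refl) , (0 , refl)
  Rpow-×F-proj (suc i) ((x₁ , _) , (inj₁ a , r , refl) , p)
    with (k , pF) , pG ← Rpow-×F-proj i p = (suc k , x₁ , (a , r) , pF) , pG
  Rpow-×F-proj (suc i) ((_ , y₁) , (inj₂ b , refl , r) , p)
    with pF , (l , pG) ← Rpow-×F-proj i p = pF , (suc l , y₁ , (b , r) , pG)

  mTransitive-×F : ∀ {m n} → mTransitive F m → mTransitive G n →
                   mTransitive (F ×F G) (m + n)
  mTransitive-×F (_ , starF⇒le) (_ , starG⇒le) =
    Rle⇒Rstar (F ×F G) ,
    λ { (x , y) (x' , y') (i , p) → let (pF , pG) = Rpow-×F-proj i p in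
        Rle-×F (starF⇒le x x' pF) (starG⇒le y y' pG) }

  ¬¬-mTransitive-×F : ∀ {m n} → ¬¬-mTransitive F m → ¬¬-mTransitive G n →
                      ¬¬-mTransitive (F ×F G) (m + n)
  ¬¬-mTransitive-×F starF⇒le starG⇒le (x , y) (x' , y') (i , p) = do
    let (pF , pG) = Rpow-×F-proj i p
    leF ← starF⇒le x x' pF
    Rle-×F leF <$> starG⇒le y y' pG

module Sat {C : Alphabet} (F : Frame C) (V : ℕ → W F → Set) where

  sat-stable : ∀ x φ → ¬ ¬ sat F V x φ → sat F V x φ
  sat-stable x (var p) ¬¬s ¬v   = ¬¬s (λ s → s ¬v)
  sat-stable x ⊥'      ¬¬s      = ¬¬s (λ s → s)
  sat-stable x (φ ⇒ ψ) ¬¬s s    = sat-stable x ψ (λ ¬t → ¬¬s (λ f → ¬t (f s)))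
  sat-stable x (◇ c φ) ¬¬s none = ¬¬s (λ s → s none)

  sat-⋁⁺ : ∀ {X : Set} x (f : X → Formula C) {l a} →
           a ∈ l → sat F V x (f a) → sat F V x (⋁ (map f l))
  sat-⋁⁺ x f (here refl) s ¬s = contradiction s ¬s
  sat-⋁⁺ x f (there a∈l) s _  = sat-⋁⁺ x f a∈l s

  sat-⋁⁻ : ∀ {X : Set} x (f : X → Formula C) (l : List X) →
           sat F V x (⋁ (map f l)) → ¬ ¬ Σ X (λ a → a ∈ l × sat F V x (f a))
  sat-⋁⁻ x f []      ()
  sat-⋁⁻ x f (b ∷ l) s ¬ex =
    sat-⋁⁻ x f l (s (λ t → ¬ex (b , here refl , t)))
      (λ (a , a∈l , t) → ¬ex (a , there a∈l , t))

  sat-◇C^⁺ : ∀ i {x y} φ → Rpow F i x y → sat F V y φ → sat F V x (◇C^ i φ)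
  sat-◇C^⁺ zero    φ refl                s = s
  sat-◇C^⁺ (suc i) φ (y , (c , r) , p) s =
    sat-⋁⁺ _ (λ c → ◇ c (◇C^ i φ)) (complete C c)
      (λ none → none y r (sat-◇C^⁺ i φ p s))

  sat-◇C^⁻ : ∀ i x φ → sat F V x (◇C^ i φ) →
             ¬ ¬ Σ (W F) (λ y → Rpow F i x y × sat F V y φ)
  sat-◇C^⁻ zero    x φ s = return (x , refl , s)
  sat-◇C^⁻ (suc i) x φ s = do
    (c , _ , s◇) ← sat-⋁⁻ x (λ c → ◇ c (◇C^ i φ)) (elems C) s
    (y , r , t)  ← (λ ¬succ → s◇ (λ y r t → ¬succ (y , r , t)))
    (z , p , u)  ← sat-◇C^⁻ i y φ t
    return (z , (y , (c , r) , p) , u)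

  sat-◇C^≤⁺ : ∀ m {x y} φ → Rle F m x y → sat F V y φ → sat F V x (◇C^≤ m φ)
  sat-◇C^≤⁺ m φ (i , i≤m , p) s =
    sat-⋁⁺ _ (λ i → ◇C^ i φ) (∈-upTo⁺ (s≤s i≤m)) (sat-◇C^⁺ i φ p s)

  sat-◇C^≤⁻ : ∀ m x φ → sat F V x (◇C^≤ m φ) →
              ¬ ¬ Σ (W F) (λ y → Rle F m x y × sat F V y φ)
  sat-◇C^≤⁻ m x φ s = do
    (i , i∈ , t) ← sat-⋁⁻ x (λ i → ◇C^ i φ) (upTo (suc m)) s
    (y , p , u)  ← sat-◇C^⁻ i x φ t
    return (y , (i , s≤s⁻¹ (∈-upTo⁻ i∈) , p) , u)

module _ {C : Alphabet} (F : Frame C) {m : ℕ} where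

  ⊨transAx⇒Rpow-suc⇒¬¬Rle : F ⊨ transAx m →
                             ∀ x y → Rpow F (suc m) x y → ¬ ¬ Rle F m x y
  ⊨transAx⇒Rpow-suc⇒¬¬Rle valid x y p = do
    (z , le , z≡y) ← sat-◇C^≤⁻ m x (var 0)
                       (valid V x (sat-◇C^⁺ (suc m) (var 0) p (return refl)))
    refl ← z≡y
    return le
    where
    V : ℕ → W F → Set
    V _ w = w ≡ y
    open Sat F V

  Rpow-suc⇒¬¬Rle⇒¬¬-mTransitive :
    (∀ x y → Rpow F (suc m) x y → ¬ ¬ Rle F m x y) → ¬¬-mTransitive F m
  Rpow-suc⇒¬¬Rle⇒¬¬-mTransitive shorten x z (i , p) = go i x p
    where
    go : ∀ i x → Rpow F i x z → ¬ ¬ Rle F m x z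
    go zero    x refl        = return (0 , z≤n , refl)
    go (suc i) x (y , r , p) = do
      (j , j≤m , q) ← go i y p
      case m≤n⇒m<n∨m≡n j≤m of λ where
        (inj₁ j<m)  → return (suc j , j<m , y , r , q)
        (inj₂ refl) → shorten x z (y , r , q)

  ⊨transAx⇒¬¬-mTransitive : F ⊨ transAx m → ¬¬-mTransitive F m
  ⊨transAx⇒¬¬-mTransitive valid =
    Rpow-suc⇒¬¬Rle⇒¬¬-mTransitive (⊨transAx⇒Rpow-suc⇒¬¬Rle valid)

  ¬¬-mTransitive⇒⊨transAx : ¬¬-mTransitive F m → F ⊨ transAx m
  ¬¬-mTransitive⇒⊨transAx trans V x s =
    sat-stable x (◇C^≤ m (var 0)) do
      (y , p , u) ← sat-◇C^⁻ (suc m) x (var 0) s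
      le ← trans x y (suc m , p)
      return (sat-◇C^≤⁺ m (var 0) le u)
    where open Sat F V

proposition3p4 :
    ((A B : Alphabet) (F : Frame A) (G : Frame B) (m n : ℕ) →
      mTransitive F m → mTransitive G n → mTransitive (F ×F G) (m + n))
    ×
    ((A B : Alphabet) (L₁ : Logic A) (L₂ : Logic B) →
      Normal L₁ → Normal L₂ → Pretransitive L₁ → Pretransitive L₂ →
      Pretransitive (L₁ ×L L₂))
proposition3p4 =
  (λ A B F G m n → mTransitive-×F F G) ,
  λ { A B L₁ L₂ _ _ (m , transL₁) (n , transL₂) →
      m + n , λ F G F⊨L₁ G⊨L₂ →
        ¬¬-mTransitive⇒⊨transAx (F ×F G)
          (¬¬-mTransitive-×F F G
            (⊨transAx⇒¬¬-mTransitive F (F⊨L₁ _ transL₁))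
            (⊨transAx⇒¬¬-mTransitive G (G⊨L₂ _ transL₂))) }
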